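{- Let $k\ge 3$ and $m\ge 1$ be integers. Let $A(k)$ be the $m$-rowed simple matrix whose columns are exactly all $(0,1)$-vectors $x\in\{0,1\}^m$ such that for every choice of rows $i_1<i_2<\cdots<i_k$, the vector $(x_{i_1},x_{i_2},\dots,x_{i_k})$ is neither the alternating vector $(1,0,1,0,\dots)$ of length $k$ nor the alternating vector $(0,1,0,1,\dots)$ of length $k$. Then for each $k$-set of rows, the length-$k$ columns missing from the restriction of $A(k)$ to those rows form a pair of complementary columns, which for $k$ even both have $k/2$ ones and for $k$ odd have $\lceil k/2\rceil$ ones and $\lfloor k/2\rfloor$ ones respectively. Moreover, the number of columns of $A(k)$ is $$f(m,k)=2\sum_{i=0}^{k-2}\binom{m-1}{i}=\binom{m-1}{k-2}+\sum_{i=0}^{k-2}\binom{m}{i}.$$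
   Context: A matrix is simple if it is a $(0,1)$-matrix with no repeated columns. Two $(0,1)$-columns are complementary if one is obtained from the other by exchanging all 0's and 1's. -}

module Defs where

open import Data.Bool using (Bool; true; false; not)
open import Data.Nat using (ℕ; zero; suc; _+_; _*_; _∸_)
open import Data.Fin using (Fin; _<_)
open import Data.Vec using (Vec; []; _∷_; lookup; tabulate; map)
open import Data.List using (List; upTo)
open import Data.Nat.ListAction using (sum)
import Data.List as L
open import Data.List.Membership.Propositional using (_∈_)
open import Data.List.Relation.Unary.Unique.Propositional using (Unique)
open import Data.Product using (Σ; _×_; ∃; _,_)
open import Data.Nat.Combinatorics using (_C_)
open import Relation.Binary.PropositionalEquality using (_≡_; _≢_)
open import Relation.Nullary using (¬_)
open import Function.Bundles using (_⇔_)

Column : ℕ → Set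
Column m = Vec Bool m

complement : ∀ {m} → Column m → Column m
complement = map not

ones : ∀ {m} → Column m → ℕ
ones []          = 0
ones (true ∷ v)  = suc (ones v)
ones (false ∷ v) = ones v

RowSet : ℕ → ℕ → Set
RowSet k m = Σ (Fin k → Fin m) λ s → ∀ i j → i < j → s i < s j

restrict : ∀ {k m} → RowSet k m → Column m → Column k
restrict (s , _) x = tabulate λ j → lookup x (s j)

alt : Bool → (n : ℕ) → Column n
alt b zero    = []
alt b (suc n) = b ∷ alt (not b) n

InA : (k : ℕ) → ∀ {m} → Column m → Set
InA k {m} x = (S : RowSet k m) →
  (restrict S x ≢ alt true k) × (restrict S x ≢ alt false k)

Missing : (k : ℕ) → ∀ {m} → RowSet k m → Column k → Set
Missing k {m} S w = ¬ (∃ λ (x : Column m) → InA k x × restrict S x ≡ w)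

-- The list L enumerates the set {x | P x} exactly, without repetition;
-- its length is thus the cardinality of that set.
Enumerates : ∀ {A : Set} → (A → Set) → List A → Set
Enumerates {A} P l = Unique l × (∀ (x : A) → (x ∈ l) ⇔ P x)

sumTo : ℕ → (ℕ → ℕ) → ℕ
sumTo n f = sum (L.map f (upTo (suc n)))

-- A column x contains an alternating vector of length 2 + j on some rows iff the
-- sequence x changes value at least 1 + j times between consecutive rows: restricting
-- to rows never creates changes, and a column with 1 + j changes has an alternating
-- subsequence through one entry of each of its runs. So A(2 + j) consists of the columns
-- with at most j changes. A vector w of length k that is not alternating has at most
-- k - 2 changes, and filling every unchosen row with the entry of w at the nearest
-- chosen row above it (or the first entry of w) gives a column with no more changes
-- restricting to w; hence only the two
-- alternating vectors are missing. A column of length 1 + n is determined by its first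
-- entry and the set of positions among its n adjacent pairs where it changes, which
-- gives 2 ∑_{i ≤ j} C(n, i) columns; Pascal's rule turns this into the second formula.
module Submission where

open import Defs
open import Data.Bool using (Bool; true; false; not; _≟_)
open import Data.Bool.Properties using (¬-not; not-¬)
open import Data.Empty using (⊥-elim)
open import Data.Fin as Fin using (Fin; zero; suc; toℕ; reduce≥)
open import Data.List as List using (List; []; _∷_; _++_; length; upTo; applyUpTo; _∷ʳ_)
open import Data.List.Membership.Propositional using (_∈_)
open import Data.List.Membership.Propositional.Properties
  using (∈-map⁺; ∈-map⁻; ∈-++⁺ˡ; ∈-++⁺ʳ; ∈-++⁻)
open import Data.List.Properties using (length-++; length-map; map-upTo; applyUpTo-∷ʳ; map-cong)
open import Data.List.Relation.Unary.Any using (here)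
open import Data.List.Relation.Unary.Unique.Propositional.Properties using (map⁺; ++⁺)
import Data.List.Relation.Unary.All as All
import Data.List.Relation.Unary.AllPairs as AllPairs
open import Data.Nat
  using (ℕ; zero; suc; _+_; _*_; _∸_; _≤_; _<_; z≤n; s≤s; s≤s⁻¹; z<s; _≤?_; ⌈_/2⌉; ⌊_/2⌋)
open import Data.Nat.Combinatorics using (_C_; nCk+nC[k+1]≡[n+1]C[k+1])
open import Data.Nat.ListAction using (sum)
open import Data.Nat.ListAction.Properties using (sum-++)
open import Data.Nat.Properties
  using (≤-refl; ≤-trans; ≤-reflexive; ≤-<-trans; +-mono-≤; +-monoˡ-≤; +-monoʳ-≤; +-assoc;
         +-identityʳ; m≤n+m; ≰⇒>; ≤∧≢⇒<; 1+n≰n; suc-injective; module ≤-Reasoning)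
  renaming (_≟_ to _≟ℕ_)
open import Data.Nat.Tactic.RingSolver using (solve-∀)
open import Data.Product using (Σ; ∃; _×_; _,_; proj₁; proj₂)
open import Data.Sum using (_⊎_; inj₁; inj₂)
open import Data.Vec using (Vec; []; _∷_; lookup)
open import Data.Vec.Properties using (∷-injectiveˡ; ∷-injectiveʳ; tabulate-cong)
open import Function using (_∘_)
open import Function.Bundles using (_⇔_; mk⇔; Equivalence)
open import Function.Properties.Equivalence using () renaming (sym to ⇔-sym)
open import Relation.Binary.PropositionalEquality
  using (_≡_; _≢_; _≗_; refl; sym; trans; cong; cong₂; subst; module ≡-Reasoning)
open import Relation.Nullary using (¬_; yes; no)

open Equivalence using (to; from)

data Thinning : ℕ → ℕ → Set where
  done : Thinning 0 0
  keep : ∀ {k m} → Thinning k m → Thinning (suc k) (suc m)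
  skip : ∀ {k m} → Thinning k m → Thinning k (suc m)

select : ∀ {A : Set} {k m} → Thinning k m → Vec A m → Vec A k
select done     []      = []
select (keep σ) (a ∷ v) = a ∷ select σ v
select (skip σ) (a ∷ v) = select σ v

noRows : ∀ {m} → RowSet 0 m
noRows = (λ ()) , λ ()

shiftRows : ∀ {k m} → RowSet k m → RowSet k (suc m)
shiftRows (s , inc) = suc ∘ s , λ i j i<j → s≤s (inc i j i<j)

consRow₀ : ∀ {k m} → RowSet k m → RowSet (suc k) (suc m)
consRow₀ {k} {m} (s , inc) = s′ , inc′
  where
  s′ : Fin (suc k) → Fin (suc m)
  s′ zero    = zero
  s′ (suc i) = suc (s i)
  inc′ : ∀ i j → i Fin.< j → s′ i Fin.< s′ j
  inc′ zero    (suc j) _   = z<s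
  inc′ (suc i) (suc j) i<j = s≤s (inc i j (s≤s⁻¹ i<j))

thinning⇒rowSet : ∀ {k m} → Thinning k m → RowSet k m
thinning⇒rowSet done     = noRows
thinning⇒rowSet (keep σ) = consRow₀ (thinning⇒rowSet σ)
thinning⇒rowSet (skip σ) = shiftRows (thinning⇒rowSet σ)

restrict-thinning⇒rowSet : ∀ {k m} (σ : Thinning k m) → restrict (thinning⇒rowSet σ) ≗ select σ
restrict-thinning⇒rowSet done     []      = refl
restrict-thinning⇒rowSet (keep σ) (a ∷ v) = cong (a ∷_) (restrict-thinning⇒rowSet σ v)
restrict-thinning⇒rowSet (skip σ) (a ∷ v) = restrict-thinning⇒rowSet σ v

tailRows : ∀ {k m} → RowSet (suc k) m → RowSet k m
tailRows (s , inc) = s ∘ suc , λ i j i<j → inc (suc i) (suc j) (s≤s i<j)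

AvoidsRow₀ : ∀ {k m} → RowSet k (suc m) → Set
AvoidsRow₀ S = ∀ i → 0 < toℕ (proj₁ S i)

reduce≥-mono : ∀ {m} {i j : Fin (suc m)} (p : 0 < toℕ i) (q : 0 < toℕ j) →
               i Fin.< j → reduce≥ {1} i p Fin.< reduce≥ {1} j q
reduce≥-mono {i = suc _} {suc _} _ _ i<j = s≤s⁻¹ i<j

lookup-reduce≥ : ∀ {A : Set} {m} (a : A) (v : Vec A m) (i : Fin (suc m)) (p : 0 < toℕ i) →
                 lookup (a ∷ v) i ≡ lookup v (reduce≥ {1} i p)
lookup-reduce≥ a v (suc i) _ = refl

dropRow₀ : ∀ {k m} (S : RowSet k (suc m)) → AvoidsRow₀ S → RowSet k m
dropRow₀ (s , inc) pos =
  (λ i → reduce≥ {1} (s i) (pos i)) , λ i j i<j → reduce≥-mono (pos i) (pos j) (inc i j i<j)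

restrict-dropRow₀ : ∀ {k m} (S : RowSet k (suc m)) (pos : AvoidsRow₀ S) a (v : Column m) →
                    restrict S (a ∷ v) ≡ restrict (dropRow₀ S pos) v
restrict-dropRow₀ (s , _) pos a v = tabulate-cong λ i → lookup-reduce≥ a v (s i) (pos i)

tailRows-avoidsRow₀ : ∀ {k m} (S : RowSet (suc k) (suc m)) → AvoidsRow₀ (tailRows S)
tailRows-avoidsRow₀ (s , inc) j = ≤-<-trans z≤n (inc zero (suc j) z<s)

first-positive⇒avoidsRow₀ : ∀ {k m} (S : RowSet (suc k) (suc m)) →
                            0 < toℕ (proj₁ S zero) → AvoidsRow₀ S
first-positive⇒avoidsRow₀ S first-positive zero    = first-positive
first-positive⇒avoidsRow₀ S first-positive (suc j) = tailRows-avoidsRow₀ S j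

zero-or-positive : ∀ {m} (r : Fin (suc m)) → r ≡ zero ⊎ 0 < toℕ r
zero-or-positive zero    = inj₁ refl
zero-or-positive (suc r) = inj₂ z<s

rowSet⇒thinning : ∀ {k m} (S : RowSet k m) → Σ (Thinning k m) λ σ → restrict S ≗ select σ
skipRow₀ : ∀ {k m} (S : RowSet k (suc m)) → AvoidsRow₀ S →
           Σ (Thinning k (suc m)) λ σ → restrict S ≗ select σ

rowSet⇒thinning {zero}  {zero}  S = done , λ { [] → refl }
rowSet⇒thinning {suc k} {zero}  (s , _) with s zero
... | ()
rowSet⇒thinning {zero}  {suc m} S = skipRow₀ S λ ()
rowSet⇒thinning {suc k} {suc m} S@(s , _) with zero-or-positive (s zero)
... | inj₂ first-positive = skipRow₀ S (first-positive⇒avoidsRow₀ S first-positive)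
... | inj₁ first-zero
      with rowSet⇒thinning (dropRow₀ (tailRows S) (tailRows-avoidsRow₀ S))
...   | σ , restrict≡select = keep σ , λ { (a ∷ v) →
          cong₂ _∷_ (cong (lookup (a ∷ v)) first-zero)
                    (trans (restrict-dropRow₀ (tailRows S) (tailRows-avoidsRow₀ S) a v) (restrict≡select v)) }

skipRow₀ S pos with rowSet⇒thinning (dropRow₀ S pos)
... | σ , restrict≡select =
  skip σ , λ { (a ∷ v) → trans (restrict-dropRow₀ S pos a v) (restrict≡select v) }

jump : Bool → Bool → ℕ
jump false false = 0
jump false true  = 1
jump true  false = 1
jump true  true  = 0

changesFrom : ∀ {n} → Bool → Column n → ℕ
changesFrom b []      = 0
changesFrom b (a ∷ v) = jump b a + changesFrom a v

changes : ∀ {n} → Column n → ℕ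
changes []      = 0
changes (a ∷ v) = changesFrom a v

jump-≤-1 : ∀ a b → jump a b ≤ 1
jump-≤-1 false false = z≤n
jump-≤-1 false true  = ≤-refl
jump-≤-1 true  false = ≤-refl
jump-≤-1 true  true  = z≤n

jump-triangle : ∀ a b c → jump a c ≤ jump a b + jump b c
jump-triangle false false c     = ≤-refl
jump-triangle true  true  c     = ≤-refl
jump-triangle false true  false = z≤n
jump-triangle false true  true  = ≤-refl
jump-triangle true  false false = ≤-refl
jump-triangle true  false true  = z≤n

changesFrom-self : ∀ b {n} (v : Column n) → changesFrom b (b ∷ v) ≡ changesFrom b v
changesFrom-self false v = refl
changesFrom-self true  v = refl

changesFrom-≤-length : ∀ b {n} (v : Column n) → changesFrom b v ≤ n
changesFrom-≤-length b []      = z≤n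
changesFrom-≤-length b (a ∷ v) = +-mono-≤ (jump-≤-1 b a) (changesFrom-≤-length a v)

changesFrom-≤-jump : ∀ b a {n} (v : Column n) → changesFrom b v ≤ jump b a + changesFrom a v
changesFrom-≤-jump b a []      = z≤n
changesFrom-≤-jump b a (c ∷ v) = begin
  jump b c + changesFrom c v                ≤⟨ +-monoˡ-≤ (changesFrom c v) (jump-triangle b a c) ⟩
  (jump b a + jump a c) + changesFrom c v   ≡⟨ +-assoc (jump b a) (jump a c) (changesFrom c v) ⟩
  jump b a + changesFrom a (c ∷ v)          ∎
  where open ≤-Reasoning

changes-≤-changesFrom : ∀ b {n} (v : Column n) → changes v ≤ changesFrom b v
changes-≤-changesFrom b []      = z≤n
changes-≤-changesFrom b (a ∷ v) = m≤n+m (changesFrom a v) (jump b a)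

changesFrom-select : ∀ b {k m} (σ : Thinning k m) (x : Column m) →
                     changesFrom b (select σ x) ≤ changesFrom b x
changesFrom-select b done     []      = ≤-refl
changesFrom-select b (keep σ) (a ∷ v) = +-monoʳ-≤ (jump b a) (changesFrom-select a σ v)
changesFrom-select b (skip σ) (a ∷ v) = ≤-trans (changesFrom-select b σ v) (changesFrom-≤-jump b a v)

changes-select : ∀ {k m} (σ : Thinning k m) (x : Column m) → changes (select σ x) ≤ changes x
changes-select done []      = z≤n
changes-select σ    (a ∷ v) = begin
  changes (select σ (a ∷ v))         ≤⟨ changes-≤-changesFrom a (select σ (a ∷ v)) ⟩
  changesFrom a (select σ (a ∷ v))   ≤⟨ changesFrom-select a σ (a ∷ v) ⟩
  changesFrom a (a ∷ v)              ≡⟨ changesFrom-self a v ⟩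
  changes (a ∷ v)                    ∎
  where open ≤-Reasoning

changes-restrict : ∀ {k m} (S : RowSet k m) (x : Column m) → changes (restrict S x) ≤ changes x
changes-restrict S x with rowSet⇒thinning S
... | σ , restrict≡select =
  ≤-trans (≤-reflexive (cong changes (restrict≡select x))) (changes-select σ x)

changesFrom-alt : ∀ b n → changesFrom b (alt (not b) n) ≡ n
changesFrom-alt b     zero    = refl
changesFrom-alt false (suc n) = cong suc (changesFrom-alt true n)
changesFrom-alt true  (suc n) = cong suc (changesFrom-alt false n)

changesFrom-maximal : ∀ b {n} (v : Column n) → changesFrom b v ≡ n → v ≡ alt (not b) n
changesFrom-maximal b     []          _    = refl
changesFrom-maximal false (false ∷ v) full =
  ⊥-elim (1+n≰n (subst (_≤ _) full (changesFrom-≤-length false v)))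
changesFrom-maximal true  (true ∷ v)  full =
  ⊥-elim (1+n≰n (subst (_≤ _) full (changesFrom-≤-length true v)))
changesFrom-maximal false (true ∷ v)  full =
  cong (true ∷_) (changesFrom-maximal true v (suc-injective full))
changesFrom-maximal true  (false ∷ v) full =
  cong (false ∷_) (changesFrom-maximal false v (suc-injective full))

select-alternating : ∀ b {m} (x : Column m) n → n ≤ changesFrom b x →
                     Σ (Thinning n m) λ σ → select σ x ≡ alt (not b) n
select-alternating b     []          zero    _ = done , refl
select-alternating b     (a ∷ v)     zero    _ with select-alternating a v zero z≤n
... | σ , picked = skip σ , picked
select-alternating false (false ∷ v) (suc n) p with select-alternating false v (suc n) p
... | σ , picked = skip σ , picked
select-alternating true  (true ∷ v)  (suc n) p with select-alternating true v (suc n) p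
... | σ , picked = skip σ , picked
select-alternating false (true ∷ v)  (suc n) (s≤s p) with select-alternating true v n p
... | σ , picked = keep σ , cong (true ∷_) picked
select-alternating true  (false ∷ v) (suc n) (s≤s p) with select-alternating false v n p
... | σ , picked = keep σ , cong (false ∷_) picked

alternating-restriction : ∀ a {m} (v : Column m) n → n ≤ changesFrom a v →
                          Σ (RowSet (suc n) (suc m)) λ S → restrict S (a ∷ v) ≡ alt a (suc n)
alternating-restriction a v n p with select-alternating a v n p
... | σ , picked =
  thinning⇒rowSet (keep σ) , trans (restrict-thinning⇒rowSet (keep σ) (a ∷ v)) (cong (a ∷_) picked)

extend : ∀ {k m} → Bool → Thinning k m → Column k → Column m
extend b done     []      = []
extend b (keep σ) (c ∷ w) = c ∷ extend c σ w
extend b (skip σ) w       = b ∷ extend b σ w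

select-extend : ∀ b {k m} (σ : Thinning k m) (w : Column k) → select σ (extend b σ w) ≡ w
select-extend b done     []      = refl
select-extend b (keep σ) (c ∷ w) = cong (c ∷_) (select-extend c σ w)
select-extend b (skip σ) w       = select-extend b σ w

changesFrom-extend : ∀ b {k m} (σ : Thinning k m) (w : Column k) →
                     changesFrom b (extend b σ w) ≡ changesFrom b w
changesFrom-extend b done     []      = refl
changesFrom-extend b (keep σ) (c ∷ w) = cong (jump b c +_) (changesFrom-extend c σ w)
changesFrom-extend b (skip σ) w       =
  trans (changesFrom-self b (extend b σ w)) (changesFrom-extend b σ w)

restriction-with-fewer-changes : ∀ {k m} (S : RowSet (suc k) m) (w : Column (suc k)) →
                                 ∃ λ x → restrict S x ≡ w × changes x ≤ changes w
restriction-with-fewer-changes S (c ∷ w) with rowSet⇒thinning S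
... | σ , restrict≡select = x , trans (restrict≡select x) (select-extend c σ (c ∷ w)) , fewer
  where
  open ≤-Reasoning
  x : Column _
  x = extend c σ (c ∷ w)
  fewer : changes x ≤ changes (c ∷ w)
  fewer = begin
    changes x                ≤⟨ changes-≤-changesFrom c x ⟩
    changesFrom c x          ≡⟨ changesFrom-extend c σ (c ∷ w) ⟩
    changesFrom c (c ∷ w)    ≡⟨ changesFrom-self c w ⟩
    changes (c ∷ w)          ∎

InA-avoids : ∀ {k m} (x : Column m) → InA k x → ∀ (S : RowSet k m) b → restrict S x ≢ alt b k
InA-avoids x inA S true  = proj₁ (inA S)
InA-avoids x inA S false = proj₂ (inA S)

changes≤⇒InA : ∀ j {m} (x : Column m) → changes x ≤ j → InA (2 + j) x
changes≤⇒InA j x few S = avoids true , avoids false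
  where
  avoids : ∀ b → restrict S x ≢ alt b (2 + j)
  avoids b restrict≡alt = 1+n≰n (begin
    suc j                      ≡⟨ changesFrom-alt b (suc j) ⟨
    changes (alt b (2 + j))    ≡⟨ cong changes restrict≡alt ⟨
    changes (restrict S x)     ≤⟨ changes-restrict S x ⟩
    changes x                  ≤⟨ few ⟩
    j                          ∎)
    where open ≤-Reasoning

InA⇒changes≤ : ∀ j {m} (x : Column m) → InA (2 + j) x → changes x ≤ j
InA⇒changes≤ j []      _   = z≤n
InA⇒changes≤ j (a ∷ v) inA with changesFrom a v ≤? j
... | yes few = few
... | no many with alternating-restriction a v (suc j) (≰⇒> many)
...   | S , restrict≡alt = ⊥-elim (InA-avoids (a ∷ v) inA S a restrict≡alt)

InA⇔changes≤ : ∀ j {m} (x : Column m) → InA (2 + j) x ⇔ changes x ≤ j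
InA⇔changes≤ j x = mk⇔ (InA⇒changes≤ j x) (changes≤⇒InA j x)

missing⇒alternating : ∀ j {m} (S : RowSet (2 + j) m) (w : Column (2 + j)) →
                      Missing (2 + j) S w → w ≡ alt true (2 + j) ⊎ w ≡ alt false (2 + j)
missing⇒alternating j S (c ∷ w) missing with changesFrom c w ≟ℕ suc j
... | yes full = true-or-false c (cong (c ∷_) (changesFrom-maximal c w full))
  where
  true-or-false : ∀ c → c ∷ w ≡ alt c (2 + j) →
                  c ∷ w ≡ alt true (2 + j) ⊎ c ∷ w ≡ alt false (2 + j)
  true-or-false true  = inj₁
  true-or-false false = inj₂
... | no not-full with restriction-with-fewer-changes S (c ∷ w)
...   | x , restrict≡w , fewer =
  ⊥-elim (missing (x , changes≤⇒InA j x (≤-trans fewer few) , restrict≡w))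
  where
  few : changesFrom c w ≤ j
  few = s≤s⁻¹ (≤∧≢⇒< (changesFrom-≤-length c w) not-full)

missing⇔alternating : ∀ j {m} (S : RowSet (2 + j) m) (w : Column (2 + j)) →
                      Missing (2 + j) S w ⇔ (w ≡ alt true (2 + j) ⊎ w ≡ alt false (2 + j))
missing⇔alternating j S w = mk⇔ (missing⇒alternating j S w) alternating⇒missing
  where
  alternating⇒missing : w ≡ alt true (2 + j) ⊎ w ≡ alt false (2 + j) → Missing (2 + j) S w
  alternating⇒missing (inj₁ refl) (x , inA , restrict≡w) = InA-avoids x inA S true restrict≡w
  alternating⇒missing (inj₂ refl) (x , inA , restrict≡w) = InA-avoids x inA S false restrict≡w

complement-alt : ∀ b n → complement (alt b n) ≡ alt (not b) n
complement-alt b zero    = refl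
complement-alt b (suc n) = cong (not b ∷_) (complement-alt (not b) n)

ones-alt-true  : ∀ n → ones (alt true n) ≡ ⌈ n /2⌉
ones-alt-false : ∀ n → ones (alt false n) ≡ ⌊ n /2⌋
ones-alt-true  zero    = refl
ones-alt-true  (suc n) = cong suc (ones-alt-false n)
ones-alt-false zero    = refl
ones-alt-false (suc n) = ones-alt-true n

missing-pair : ∀ j {m} (S : RowSet (2 + j) m) → ∃ λ y →
               (∀ w → Missing (2 + j) S w ⇔ (w ≡ y ⊎ w ≡ complement y))
               × ones y ≡ ⌈ 2 + j /2⌉ × ones (complement y) ≡ ⌊ 2 + j /2⌋
missing-pair j S =
  alt true k ,
  (λ w → subst (λ y′ → Missing k S w ⇔ (w ≡ alt true k ⊎ w ≡ y′)) (sym (complement-alt true k))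
               (missing⇔alternating j S w)) ,
  ones-alt-true k ,
  trans (cong ones (complement-alt true k)) (ones-alt-false k)
  where
  k : ℕ
  k = 2 + j

sumTo-head : ∀ c f → sumTo (suc c) f ≡ f 0 + sumTo c (f ∘ suc)
sumTo-head c f = begin
  sum (List.map f (upTo (2 + c)))            ≡⟨ cong sum (map-upTo f (2 + c)) ⟩
  f 0 + sum (applyUpTo (f ∘ suc) (suc c))    ≡⟨ cong (λ l → f 0 + sum l) (map-upTo (f ∘ suc) (suc c)) ⟨
  f 0 + sumTo c (f ∘ suc)                    ∎
  where open ≡-Reasoning

sumTo-last : ∀ c f → sumTo (suc c) f ≡ sumTo c f + f (suc c)
sumTo-last c f = begin
  sum (List.map f (upTo (2 + c)))              ≡⟨ cong sum (map-upTo f (2 + c)) ⟩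
  sum (applyUpTo f (2 + c))                    ≡⟨ cong sum (applyUpTo-∷ʳ f (suc c)) ⟨
  sum (applyUpTo f (suc c) ∷ʳ f (suc c))       ≡⟨ sum-++ (applyUpTo f (suc c)) (f (suc c) ∷ []) ⟩
  sum (applyUpTo f (suc c)) + (f (suc c) + 0)
    ≡⟨ cong₂ _+_ (sym (cong sum (map-upTo f (suc c)))) (+-identityʳ (f (suc c))) ⟩
  sumTo c f + f (suc c)                        ∎
  where open ≡-Reasoning

sumTo-cong : ∀ c {f g : ℕ → ℕ} → (∀ i → f i ≡ g i) → sumTo c f ≡ sumTo c g
sumTo-cong c f≗g = cong sum (map-cong f≗g (upTo (suc c)))

sum-map-+ : ∀ (f g : ℕ → ℕ) l →
            sum (List.map (λ i → f i + g i) l) ≡ sum (List.map f l) + sum (List.map g l)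
sum-map-+ f g []      = refl
sum-map-+ f g (i ∷ l) = begin
  (f i + g i) + sum (List.map (λ i → f i + g i) l)          ≡⟨ cong (f i + g i +_) (sum-map-+ f g l) ⟩
  (f i + g i) + (sum (List.map f l) + sum (List.map g l))   ≡⟨ +-interchange (f i) (g i) _ _ ⟩
  (f i + sum (List.map f l)) + (g i + sum (List.map g l))   ∎
  where
  open ≡-Reasoning
  +-interchange : ∀ a b c d → (a + b) + (c + d) ≡ (a + c) + (b + d)
  +-interchange = solve-∀

sumTo-0C : ∀ c → sumTo c (0 C_) ≡ 1
sumTo-0C zero    = refl
sumTo-0C (suc c) = trans (sumTo-last c (0 C_)) (trans (+-identityʳ (sumTo c (0 C_))) (sumTo-0C c))

sumTo-pascal : ∀ n c → sumTo (suc c) (suc n C_) ≡ sumTo (suc c) (n C_) + sumTo c (n C_)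
sumTo-pascal n c = begin
  sumTo (suc c) (suc n C_)
    ≡⟨ sumTo-head c (suc n C_) ⟩
  1 + sumTo c (λ i → suc n C suc i)
    ≡⟨ cong (1 +_) (sumTo-cong c λ i → nCk+nC[k+1]≡[n+1]C[k+1] n i) ⟨
  1 + sumTo c (λ i → n C i + n C suc i)
    ≡⟨ cong (1 +_) (sum-map-+ (n C_) (λ i → n C suc i) (upTo (suc c))) ⟩
  1 + (sumTo c (n C_) + sumTo c (λ i → n C suc i))
    ≡⟨ +-rearrange 1 (sumTo c (n C_)) (sumTo c (λ i → n C suc i)) ⟩
  (1 + sumTo c (λ i → n C suc i)) + sumTo c (n C_)
    ≡⟨ cong (_+ sumTo c (n C_)) (sumTo-head c (n C_)) ⟨
  sumTo (suc c) (n C_) + sumTo c (n C_)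
    ∎
  where
  open ≡-Reasoning
  +-rearrange : ∀ a b c → a + (b + c) ≡ (a + c) + b
  +-rearrange = solve-∀

double-sumTo-C : ∀ n c → 2 * sumTo c (n C_) ≡ n C c + sumTo c (suc n C_)
double-sumTo-C n zero    = refl
double-sumTo-C n (suc c) = begin
  2 * S′                          ≡⟨ twice S′ ⟩
  S′ + S′                         ≡⟨ cong (S′ +_) (sumTo-last c (n C_)) ⟩
  S′ + (S + n C suc c)            ≡⟨ +-rearrange S′ S (n C suc c) ⟩
  n C suc c + (S′ + S)            ≡⟨ cong (n C suc c +_) (sumTo-pascal n c) ⟨
  n C suc c + sumTo (suc c) (suc n C_) ∎
  where
  open ≡-Reasoning
  S S′ : ℕ
  S  = sumTo c (n C_)
  S′ = sumTo (suc c) (n C_)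
  twice : ∀ a → 2 * a ≡ a + a
  twice = solve-∀
  +-rearrange : ∀ a b c → a + (b + c) ≡ c + (a + b)
  +-rearrange = solve-∀

Enumerates-cong : ∀ {A : Set} {P Q : A → Set} {l} →
                  (∀ x → P x ⇔ Q x) → Enumerates P l → Enumerates Q l
Enumerates-cong P⇔Q (unique , mem) =
  unique , λ x → mk⇔ (to (P⇔Q x) ∘ to (mem x)) (from (mem x) ∘ from (P⇔Q x))

Enumerates-[] : ∀ {A : Set} {P : A → Set} → (∀ x → ¬ P x) → Enumerates P []
Enumerates-[] ¬P = AllPairs.[] , λ x → mk⇔ (λ ()) (⊥-elim ∘ ¬P x)

Enumerates-byHead : ∀ {n} {P : Column (suc n) → Set} b {l₁ l₂} →
                    Enumerates (λ v → P (b ∷ v)) l₁ → Enumerates (λ v → P (not b ∷ v)) l₂ →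
                    Enumerates P (List.map (b ∷_) l₁ ++ List.map (not b ∷_) l₂)
Enumerates-byHead {P = P} b {l₁} {l₂} (unique₁ , mem₁) (unique₂ , mem₂) =
  ++⁺ (map⁺ ∷-injectiveʳ unique₁) (map⁺ ∷-injectiveʳ unique₂) disjoint ,
  λ x → mk⇔ member⇒P (P⇒member x)
  where
  disjoint : ∀ {x} → ¬ (x ∈ List.map (b ∷_) l₁ × x ∈ List.map (not b ∷_) l₂)
  disjoint (p , q) with ∈-map⁻ (b ∷_) p | ∈-map⁻ (not b ∷_) q
  ... | _ , _ , refl | _ , _ , heads = not-¬ refl (∷-injectiveˡ heads)
  member⇒P : ∀ {x} → x ∈ List.map (b ∷_) l₁ ++ List.map (not b ∷_) l₂ → P x
  member⇒P p with ∈-++⁻ (List.map (b ∷_) l₁) p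
  ... | inj₁ q with ∈-map⁻ (b ∷_) q
  ...   | v , v∈l₁ , refl = to (mem₁ v) v∈l₁
  member⇒P p | inj₂ q with ∈-map⁻ (not b ∷_) q
  ...   | v , v∈l₂ , refl = to (mem₂ v) v∈l₂
  P⇒member : ∀ x → P x → x ∈ List.map (b ∷_) l₁ ++ List.map (not b ∷_) l₂
  P⇒member (a ∷ v) Px with a ≟ b
  ... | yes refl = ∈-++⁺ˡ (∈-map⁺ (a ∷_) (from (mem₁ v) Px))
  ... | no a≢b rewrite ¬-not a≢b =
    ∈-++⁺ʳ (List.map (b ∷_) l₁) (∈-map⁺ (not b ∷_) (from (mem₂ v) Px))

length-byHead : ∀ {n} b (l₁ l₂ : List (Column n)) →
                length (List.map (b ∷_) l₁ ++ List.map (not b ∷_) l₂) ≡ length l₁ + length l₂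
length-byHead b l₁ l₂ = trans (length-++ (List.map (b ∷_) l₁))
                              (cong₂ _+_ (length-map (b ∷_) l₁) (length-map (not b ∷_) l₂))

withChangesFrom≤ : ∀ n → Bool → ℕ → List (Column n)
withChangesFrom< : ∀ n → Bool → ℕ → List (Column n)
withChangesFrom≤ zero    b c = [] ∷ []
withChangesFrom≤ (suc n) b c =
  List.map (b ∷_) (withChangesFrom≤ n b c) ++ List.map (not b ∷_) (withChangesFrom< n (not b) c)
withChangesFrom< n b zero    = []
withChangesFrom< n b (suc c) = withChangesFrom≤ n b c

withChangesFrom≤-enumerates : ∀ n b c →
                              Enumerates (λ v → changesFrom b v ≤ c) (withChangesFrom≤ n b c)
withChangesFrom<-enumerates : ∀ n b c →
                              Enumerates (λ v → changesFrom b v < c) (withChangesFrom< n b c)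
withChangesFrom≤-enumerates zero    b     c =
  All.[] AllPairs.∷ AllPairs.[] , λ { [] → mk⇔ (λ _ → z≤n) (λ _ → here refl) }
withChangesFrom≤-enumerates (suc n) false c =
  Enumerates-byHead false (withChangesFrom≤-enumerates n false c) (withChangesFrom<-enumerates n true c)
withChangesFrom≤-enumerates (suc n) true  c =
  Enumerates-byHead true (withChangesFrom≤-enumerates n true c) (withChangesFrom<-enumerates n false c)
withChangesFrom<-enumerates n b zero    = Enumerates-[] λ _ ()
withChangesFrom<-enumerates n b (suc c) =
  Enumerates-cong (λ _ → mk⇔ s≤s s≤s⁻¹) (withChangesFrom≤-enumerates n b c)

length-withChangesFrom≤ : ∀ n b c → length (withChangesFrom≤ n b c) ≡ sumTo c (n C_)
length-withChangesFrom≤ zero    b c       = sym (sumTo-0C c)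
length-withChangesFrom≤ (suc n) b zero    =
  trans (length-byHead b (withChangesFrom≤ n b zero) [])
        (cong (_+ 0) (length-withChangesFrom≤ n b zero))
length-withChangesFrom≤ (suc n) b (suc c) = begin
  length (withChangesFrom≤ (suc n) b (suc c))
    ≡⟨ length-byHead b (withChangesFrom≤ n b (suc c)) (withChangesFrom≤ n (not b) c) ⟩
  length (withChangesFrom≤ n b (suc c)) + length (withChangesFrom≤ n (not b) c)
    ≡⟨ cong₂ _+_ (length-withChangesFrom≤ n b (suc c)) (length-withChangesFrom≤ n (not b) c) ⟩
  sumTo (suc c) (n C_) + sumTo c (n C_)
    ≡⟨ sumTo-pascal n c ⟨
  sumTo (suc c) (suc n C_)
    ∎
  where open ≡-Reasoning

withChanges≤ : ∀ n → ℕ → List (Column (suc n))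
withChanges≤ n c =
  List.map (true ∷_) (withChangesFrom≤ n true c) ++ List.map (false ∷_) (withChangesFrom≤ n false c)

withChanges≤-enumerates : ∀ n c → Enumerates (λ x → changes x ≤ c) (withChanges≤ n c)
withChanges≤-enumerates n c =
  Enumerates-byHead true (withChangesFrom≤-enumerates n true c) (withChangesFrom≤-enumerates n false c)

length-withChanges≤ : ∀ n c → length (withChanges≤ n c) ≡ 2 * sumTo c (n C_)
length-withChanges≤ n c = begin
  length (withChanges≤ n c)
    ≡⟨ length-byHead true (withChangesFrom≤ n true c) (withChangesFrom≤ n false c) ⟩
  length (withChangesFrom≤ n true c) + length (withChangesFrom≤ n false c)
    ≡⟨ cong₂ _+_ (length-withChangesFrom≤ n true c) (length-withChangesFrom≤ n false c) ⟩
  sumTo c (n C_) + sumTo c (n C_)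
    ≡⟨ cong (sumTo c (n C_) +_) (+-identityʳ (sumTo c (n C_))) ⟨
  2 * sumTo c (n C_)
    ∎
  where open ≡-Reasoning

A-enumerates : ∀ j n → Enumerates (InA (2 + j) {suc n}) (withChanges≤ n j)
A-enumerates j n = Enumerates-cong (λ x → ⇔-sym (InA⇔changes≤ j x)) (withChanges≤-enumerates n j)

lemma2p2 : (k m : ℕ) → 3 ≤ k → 1 ≤ m →
    ((S : RowSet k m) → ∃ λ (y : Column k) →
        ((w : Column k) → Missing k S w ⇔ (w ≡ y ⊎ w ≡ complement y))
        × ones y ≡ ⌈ k /2⌉ × ones (complement y) ≡ ⌊ k /2⌋)
    × (∃ λ l → Enumerates (InA k {m}) l
        × length l ≡ 2 * sumTo (k ∸ 2) (λ i → (m ∸ 1) C i)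
        × length l ≡ ((m ∸ 1) C (k ∸ 2)) + sumTo (k ∸ 2) (λ i → m C i))
lemma2p2 (suc (suc j)) (suc n) (s≤s (s≤s _)) (s≤s z≤n) =  -- only k ≥ 2 is needed
  missing-pair j ,
  (withChanges≤ n j ,
   A-enumerates j n ,
   length-withChanges≤ n j ,
   trans (length-withChanges≤ n j) (double-sumTo-C n j))
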